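{- Let $n\ge2$ and $k\ge1$ be integers. For every integer $r$, $$\bigl|\mathcal{C}_r(n,k)\sqcup\mathcal{C}_r(n,k-2)\bigr|=\Bigl|\bigsqcup_{s\in\mathcal{R}_{n,1}}\mathcal{C}_{r+s}(n,k-1)\Bigr|,$$ where $\sqcup$ denotes disjoint union. Moreover $|\mathcal{C}_r(n,k)|=a^{(n)}_{k,r}$.
   Context: For $n\ge2$, $k\ge1$, $L^{\mathrm{Fib}}(n,k)$ is the set of integer $k$-tuples $T=(T_1,\ldots,T_k)$ with $T_j\in\{(j-1)n+1,\ldots,jn\}$ for all $j$ and $T_{j+1}\neq T_j+1$ for $1\le j\le k-1$; $L^{\mathrm{Fib}}(n,0)$ consists of the single empty tuple and $L^{\mathrm{Fib}}(n,-1)=\emptyset$. For $k\ge0$ let $\mathcal{R}_{n,k}:=\{ -k(n-1),-k(n-1)+2,\ldots,k(n-1)-2,k(n-1)\}$. The centered rank of $T\in L^{\mathrm{Fib}}(n,k)$ is $\rho^{\mathrm{ctr}}(T):=k(kn+1)-2\sum_{i=1}^kT_i\in\mathcal{R}_{n,k}$. Set $\mathcal{C}_r(n,k):=\{T\in L^{\mathrm{Fib}}(n,k):\rho^{\mathrm{ctr}}(T)=r\}$ for $r\in\mathcal{R}_{n,k}$ and $\mathcal{C}_r(n,k):=\emptyset$ otherwise (in particular always for $k=-1$). Symmetric Fibonacci triangle: $a^{(n)}_{k,r}=0$ for $r\notin\mathcal{R}_{n,k}$, $a^{(n)}_{0,0}=1$, $a^{(n)}_{1,r}=1$ for $r\in\mathcal{R}_{n,1}$,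 and for $k\ge2$, $a^{(n)}_{k,r}=\sum_{s\in\mathcal{R}_{n,1}}a^{(n)}_{k-1,r+s}-a^{(n)}_{k-2,r}$ for $r\in\mathcal{R}_{n,k}$. -}

module Defs where

open import Data.Bool using (Bool; true; false; _∧_; _∨_; not; if_then_else_; T)
open import Data.Nat as ℕ using (ℕ; zero; suc)
open import Data.Integer as ℤ using (ℤ; +_; -[1+_]; _≤ᵇ_; 0ℤ; 1ℤ)
open import Data.Integer.Properties using () renaming (_≟_ to _≟ℤ_)
open import Data.Fin using (Fin; toℕ)
open import Data.Vec using (Vec; lookup)
open import Data.List using (List; []; _∷_; map; upTo; allFin)
open import Data.Bool.ListAction using (all; any)
open import Data.Product using (Σ)
open import Data.Empty using (⊥)
open import Relation.Nullary.Decidable using (⌊_⌋)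

_==ℤ_ : ℤ → ℤ → Bool
x ==ℤ y = ⌊ x ≟ℤ y ⌋

sumℤ : List ℤ → ℤ
sumℤ [] = 0ℤ
sumℤ (x ∷ xs) = x ℤ.+ sumℤ xs

sumVec : {k : ℕ} → Vec ℤ k → ℤ
sumVec Data.Vec.[] = 0ℤ
sumVec (x Data.Vec.∷ xs) = x ℤ.+ sumVec xs

Rlist : ℕ → ℕ → List ℤ
Rlist n k = map (λ i → (ℤ.- (+ (k ℕ.* (n ℕ.∸ 1)))) ℤ.+ (+ (2 ℕ.* i)))
                (upTo (suc (k ℕ.* (n ℕ.∸ 1))))

inR : ℕ → ℕ → ℤ → Bool
inR n k r = any (λ s → r ==ℤ s) (Rlist n k)

-- the (0-based) i-th entry lies in the block {i n + 1, ..., (i+1) n}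
inBlock : ℕ → ℕ → ℤ → Bool
inBlock n i x = (+ (i ℕ.* n ℕ.+ 1) ≤ᵇ x) ∧ (x ≤ᵇ + (suc i ℕ.* n))

isLFib : (n k : ℕ) → Vec ℤ k → Bool
isLFib n k t =
  all (λ i → inBlock n (toℕ i) (lookup t i)) (allFin k) ∧
  all (λ i → all (λ j → not (toℕ j ℕ.≡ᵇ suc (toℕ i))
                        ∨ not (lookup t j ==ℤ (lookup t i ℤ.+ 1ℤ)))
                 (allFin k))
      (allFin k)

rankCtr : (n k : ℕ) → Vec ℤ k → ℤ
rankCtr n k t = + (k ℕ.* (k ℕ.* n ℕ.+ 1)) ℤ.- (+ 2 ℤ.* sumVec t)

-- C_r(n,k) for k ≥ 0, as a subtype of integer k-tuples (Bool-valued predicate,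
-- so elements are determined by the tuple)
C : (n k : ℕ) → ℤ → Set
C n k r = Σ (Vec ℤ k) (λ t → T (inR n k r ∧ isLFib n k t ∧ (rankCtr n k t ==ℤ r)))

-- C_r(n,k) for integer k; empty for negative k (only k = -1 is used)
Cℤ : ℕ → ℤ → ℤ → Set
Cℤ n (+ k) r = C n k r
Cℤ n -[1+ _ ] r = ⊥

a : ℕ → ℕ → ℤ → ℤ
a n zero r = if r ==ℤ 0ℤ then 1ℤ else 0ℤ
a n (suc zero) r = if inR n 1 r then 1ℤ else 0ℤ
a n (suc (suc k)) r =
  if inR n (suc (suc k)) r
  then sumℤ (map (λ s → a n (suc k) (r ℤ.+ s)) (Rlist n 1)) ℤ.- a n k r
  else 0ℤ

module Submission where

-- Removing the first entry x ∈ {1, …, n} of a tuple in C_r(n,k) and lowering the remaining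
-- entries by n gives a tuple in C_{r+s}(n,k−1), where s = 2x − n − 1 ∈ R_{n,1}. Conversely x can
-- be put in front of any raised tuple of C_{r+s}(n,k−1) unless this creates a step x, x + 1.
-- Since the raised entries exceed n, that happens exactly for x = n in front of a tuple starting
-- with 1, and dropping this 1 identifies the exceptional tuples with C_r(n,k−2). Counting both
-- sides of the bijection, |C_r(n,k)| satisfies the recurrence defining a^{(n)}_{k,r} for
-- r ∈ R_{n,k}, and both vanish otherwise; induction on k finishes the proof.

open import Defs
open import Data.Nat using (ℕ; _≤_)
open import Data.Integer using (ℤ; +_; _+_; _-_)
open import Data.Fin using (Fin)
open import Data.Bool using (T)
open import Data.Sum using (_⊎_)
open import Data.Product using (Σ; _×_; proj₁)
open import Function.Bundles using (_↔_)
open import Relation.Binary.PropositionalEquality using (_≡_)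

open import Data.Bool using (Bool; true; false; _∧_; _∨_; not; if_then_else_)
open import Data.Bool.Properties using (T-∧; T-irrelevant; ∧-identityʳ; ∧-zeroʳ)
open import Data.Bool.ListAction using (all; any)
open import Data.Empty using (⊥; ⊥-elim)
open import Data.Fin using (zero; suc; toℕ; fromℕ; fromℕ<)
import Data.Fin.Properties as Finₚ
open import Data.Fin.Permutation using (↔⇒≡)
import Data.Integer as ℤ using (_≤_)
open import Data.Integer using (-[1+_]; -_; _*_; 0ℤ; 1ℤ; _≤ᵇ_; +≤+)
import Data.Integer.Properties as ℤₚ
open import Data.Integer.Tactic.RingSolver using (solve-∀)
open import Data.List using (map; upTo; applyUpTo; tabulate; allFin)
import Data.List.Properties as Listₚ
open import Data.Nat using (zero; suc; _<_; s≤s; z≤n; _≡ᵇ_) renaming (_+_ to _+ℕ_; _*_ to _*ℕ_; _∸_ to _∸ℕ_)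
import Data.Nat.Properties as ℕₚ
open import Data.Product using (_,_; proj₂)
open import Data.Product.Function.Dependent.Propositional using (Σ-↔)
open import Data.Sum using (inj₁; inj₂)
open import Data.Sum.Function.Propositional using (_⊎-↔_)
open import Data.Vec as Vec using (Vec; []; _∷_; lookup)
import Data.Vec.Properties as Vecₚ
open import Function using (_∘_; _⇔_; mk⇔; Equivalence; Inverse; mk↔ₛ′)
open import Function.Properties.Inverse using (↔-refl; ↔-sym; ↔-trans)
open import Relation.Binary.PropositionalEquality
  using (refl; sym; trans; cong; cong₂; subst; subst₂; _≢_; module ≡-Reasoning)
open import Relation.Nullary using (yes; no)
open import Relation.Nullary.Decidable using (toWitness; fromWitness)

private
  variable
    k m s : ℕ
    A B X : Set

-- Booleans and finite cardinalities

T-Σ-≡ : {P : X → Bool} {x y : X} {p : T (P x)} {q : T (P y)} →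
        x ≡ y → _≡_ {A = Σ X (T ∘ P)} (x , p) (y , q)
T-Σ-≡ {p = p} {q} refl = cong (_ ,_) (T-irrelevant p q)

T-injective : {a b : Bool} → T a ⇔ T b → a ≡ b
T-injective {false} {false} _ = refl
T-injective {false} {true}  e = ⊥-elim (Equivalence.from e _)
T-injective {true}  {false} e = ⊥-elim (Equivalence.to e _)
T-injective {true}  {true}  _ = refl

∧-interchange : ∀ a b c d → (a ∧ b) ∧ (c ∧ d) ≡ (a ∧ c) ∧ (b ∧ d)
∧-interchange false b c d = refl
∧-interchange true  b true  d = refl
∧-interchange true  b false d = ∧-zeroʳ b

allᶠ : (Fin k → Bool) → Bool
allᶠ {zero}  p = true
allᶠ {suc k} p = p zero ∧ allᶠ (p ∘ suc)

all-tabulate : (f : Fin k → A) (p : A → Bool) → all p (tabulate f) ≡ allᶠ (p ∘ f)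
all-tabulate {zero}  f p = refl
all-tabulate {suc k} f p = cong (p (f zero) ∧_) (all-tabulate (f ∘ suc) p)

allᶠ-cong : {p q : Fin k → Bool} → (∀ i → p i ≡ q i) → allᶠ p ≡ allᶠ q
allᶠ-cong {zero}  e = refl
allᶠ-cong {suc k} e = cong₂ _∧_ (e zero) (allᶠ-cong (e ∘ suc))

allᶠ-true : allᶠ {k} (λ _ → true) ≡ true
allᶠ-true {zero}  = refl
allᶠ-true {suc k} = allᶠ-true {k}

sumᶠ : (Fin m → ℕ) → ℕ
sumᶠ {zero}  f = 0
sumᶠ {suc m} f = f zero +ℕ sumᶠ (f ∘ suc)

Σ-Fin0↔ : (F : Fin 0 → Set) → Σ (Fin 0) F ↔ Fin 0
Σ-Fin0↔ F = mk↔ₛ′ (λ { (() , _) }) (λ ()) (λ ()) (λ { (() , _) })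

Σ-Fin-suc↔ : (F : Fin (suc m) → Set) → Σ (Fin (suc m)) F ↔ (F zero ⊎ Σ (Fin m) (F ∘ suc))
Σ-Fin-suc↔ F = mk↔ₛ′ to from (λ { (inj₁ _) → refl ; (inj₂ _) → refl })
                              (λ { (zero , _) → refl ; (suc _ , _) → refl })
  where
  to : Σ _ F → F zero ⊎ Σ _ (F ∘ suc)
  to (zero  , x) = inj₁ x
  to (suc i , x) = inj₂ (i , x)
  from : F zero ⊎ Σ _ (F ∘ suc) → Σ _ F
  from (inj₁ x)       = zero , x
  from (inj₂ (i , x)) = suc i , x

Σ-Fin↔sumᶠ : (f : Fin m → ℕ) → Σ (Fin m) (Fin ∘ f) ↔ Fin (sumᶠ f)
Σ-Fin↔sumᶠ {zero}  f = Σ-Fin0↔ _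
Σ-Fin↔sumᶠ {suc m} f = ↔-trans (Σ-Fin-suc↔ _)
  (↔-trans (↔-refl ⊎-↔ Σ-Fin↔sumᶠ (f ∘ suc)) (↔-sym Finₚ.+↔⊎))

Σ-Fin-cast↔ : ∀ {m m′} → m ≡ m′ → (P : ℕ → Set) → Σ (Fin m) (P ∘ toℕ) ↔ Σ (Fin m′) (P ∘ toℕ)
Σ-Fin-cast↔ refl P = ↔-refl

indicator : Bool → ℕ
indicator b = if b then 1 else 0

+-indicator : ∀ b → + indicator b ≡ (if b then 1ℤ else 0ℤ)
+-indicator true  = refl
+-indicator false = refl

T↔Fin-indicator : ∀ b → T b ↔ Fin (indicator b)
T↔Fin-indicator true  = mk↔ₛ′ (λ _ → zero) (λ _ → _) (λ { zero → refl }) (λ _ → refl)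
T↔Fin-indicator false = mk↔ₛ′ (λ ()) (λ ()) (λ ()) (λ ())

subset↔Fin : (P : Fin s → Bool) → Σ (Fin s) (T ∘ P) ↔ Fin (sumᶠ (indicator ∘ P))
subset↔Fin P = ↔-trans (Σ-↔ ↔-refl (λ {i} → T↔Fin-indicator (P i))) (Σ-Fin↔sumᶠ _)

subsingleton↔Fin-indicator : ∀ b → (∀ (x y : A) → x ≡ y) → (T b → A) → (A → T b) → A ↔ Fin (indicator b)
subsingleton↔Fin-indicator b irr intro elim =
  ↔-trans (mk↔ₛ′ elim intro (λ _ → T-irrelevant _ _) (λ _ → irr _ _)) (T↔Fin-indicator b)

isInj₁ : A ⊎ B → Bool
isInj₁ (inj₁ _) = true
isInj₁ (inj₂ _) = false

fromInj₁ : (x : A ⊎ B) → T (isInj₁ x) → A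
fromInj₁ (inj₁ a) _ = a

inj₁-fromInj₁ : (x : A ⊎ B) (p : T (isInj₁ x)) → inj₁ (fromInj₁ x p) ≡ x
inj₁-fromInj₁ (inj₁ a) _ = refl

fromInj₁-inj₁ : {a : A} (x : A ⊎ B) (p : T (isInj₁ x)) → x ≡ inj₁ a → fromInj₁ x p ≡ a
fromInj₁-inj₁ _ _ refl = refl

inj₁-fibre↔ : {A B X : Set} (φ : (A ⊎ B) ↔ X) → A ↔ Σ X (T ∘ isInj₁ ∘ Inverse.from φ)
inj₁-fibre↔ {A} {B} {X} φ = mk↔ₛ′ to′ from′ to∘from from∘to
  where
  open Inverse φ
  to′ : A → Σ X (T ∘ isInj₁ ∘ from)
  to′ a = to (inj₁ a) , subst (T ∘ isInj₁) (sym (strictlyInverseʳ (inj₁ a))) _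
  from′ : Σ X (T ∘ isInj₁ ∘ from) → A
  from′ (x , p) = fromInj₁ (from x) p
  to∘from : ∀ y → to′ (from′ y) ≡ y
  to∘from (x , p) = T-Σ-≡ (trans (cong to (inj₁-fromInj₁ (from x) p)) (strictlyInverseˡ x))
  from∘to : ∀ a → from′ (to′ a) ≡ a
  from∘to a = fromInj₁-inj₁ _ _ (strictlyInverseʳ (inj₁ a))

⊎-cancelʳ-Fin : {A B : Set} {s m : ℕ} → (A ⊎ B) ↔ Fin s → B ↔ Fin m → Σ ℕ λ l → (A ↔ Fin l) × (l +ℕ m ≡ s)
⊎-cancelʳ-Fin {A} φ ψ = _ , A↔Fin , ↔⇒≡ (↔-trans Finₚ.+↔⊎ (↔-trans (↔-sym A↔Fin ⊎-↔ ↔-sym ψ) φ))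
  where
  A↔Fin : A ↔ Fin (sumᶠ (indicator ∘ isInj₁ ∘ Inverse.from φ))
  A↔Fin = ↔-trans (inj₁-fibre↔ φ) (subset↔Fin _)

==ℤ⇒≡ : {x y : ℤ} → T (x ==ℤ y) → x ≡ y
==ℤ⇒≡ = toWitness

≡⇒==ℤ : {x y : ℤ} → x ≡ y → T (x ==ℤ y)
≡⇒==ℤ = fromWitness

≢⇒not-==ℤ : {x y : ℤ} → x ≢ y → T (not (x ==ℤ y))
≢⇒not-==ℤ {x} {y} x≢y with x ℤₚ.≟ y
... | yes x≡y = x≢y x≡y
... | no  _   = _

i+j-j≡i : ∀ (i j : ℤ) → (i + j) - j ≡ i
i+j-j≡i = solve-∀

i-j+j≡i : ∀ (i j : ℤ) → (i - j) + j ≡ i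
i-j+j≡i = solve-∀

+-cancelʳ-≡ : ∀ {i j k : ℤ} → i + k ≡ j + k → i ≡ j
+-cancelʳ-≡ {i} {j} {k} e = trans (sym (i+j-j≡i i k)) (trans (cong (_- k) e) (i+j-j≡i j k))

+-cancelˡ-≡ : ∀ k {i j : ℤ} → k + i ≡ k + j → i ≡ j
+-cancelˡ-≡ k {i} {j} e = +-cancelʳ-≡ (trans (ℤₚ.+-comm i k) (trans e (ℤₚ.+-comm k j)))

+-transpose : ∀ {b w s r : ℤ} → w + s ≡ 0ℤ → (b + w ≡ r) ⇔ (b ≡ r + s)
+-transpose {b} {w} {s} {r} w+s≡0 = mk⇔
  (λ { refl → trans (sym (ℤₚ.+-identityʳ b)) (trans (cong (λ z → b + z) (sym w+s≡0)) (assoc b w s)) })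
  (λ { refl → trans (sym (assoc r s w)) (trans (cong (λ z → r + z) (trans (ℤₚ.+-comm s w) w+s≡0)) (ℤₚ.+-identityʳ _)) })
  where
  assoc : ∀ (a b c : ℤ) → a + (b + c) ≡ (a + b) + c
  assoc = solve-∀

+[m+n]-+m≡+n : ∀ m n → + (m +ℕ n) - + m ≡ + n
+[m+n]-+m≡+n m n = trans (cong (_- + m) (ℤₚ.pos-+ m n)) (i+j-i≡j (+ m) (+ n))
  where
  i+j-i≡j : ∀ (i j : ℤ) → (i + j) - i ≡ j
  i+j-i≡j = solve-∀

≤ᵇ-shift : ∀ (u v c : ℤ) → (u ≤ᵇ v) ≡ ((u - c) ≤ᵇ (v - c))
≤ᵇ-shift u v c = T-injective (mk⇔
  (λ p → ℤₚ.≤⇒≤ᵇ (ℤₚ.+-monoˡ-≤ (- c) (ℤₚ.≤ᵇ⇒≤ {u} {v} p)))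
  (λ p → ℤₚ.≤⇒≤ᵇ (subst₂ ℤ._≤_ (i-j+j≡i u c) (i-j+j≡i v c)
                     (ℤₚ.+-monoˡ-≤ c (ℤₚ.≤ᵇ⇒≤ {u - c} {v - c} p)))))

-- Tuples in L^Fib(n,k) and their centered rank

shiftDown shiftUp : ℕ → Vec ℤ k → Vec ℤ k
shiftDown n = Vec.map (_- + n)
shiftUp   n = Vec.map (_+ + n)

shiftDown-shiftUp : ∀ n (v : Vec ℤ k) → shiftDown n (shiftUp n v) ≡ v
shiftDown-shiftUp n []       = refl
shiftDown-shiftUp n (y ∷ ys) = cong₂ _∷_ (i+j-j≡i y (+ n)) (shiftDown-shiftUp n ys)

shiftUp-shiftDown : ∀ n (v : Vec ℤ k) → shiftUp n (shiftDown n v) ≡ v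
shiftUp-shiftDown n []       = refl
shiftUp-shiftDown n (y ∷ ys) = cong₂ _∷_ (i-j+j≡i y (+ n)) (shiftUp-shiftDown n ys)

noStep : ℤ → Vec ℤ k → Bool
noStep x []      = true
noStep x (y ∷ _) = not (y ==ℤ (x + 1ℤ))

inBlocks : ℕ → Vec ℤ k → Bool
inBlocks n t = allᶠ (λ i → inBlock n (toℕ i) (lookup t i))

noStepAt : Vec ℤ k → Fin k → Fin k → Bool
noStepAt t i j = not (toℕ j ≡ᵇ suc (toℕ i)) ∨ not (lookup t j ==ℤ (lookup t i + 1ℤ))

noSteps : Vec ℤ k → Bool
noSteps t = allᶠ (λ i → allᶠ (noStepAt t i))

isLFib-≡ : ∀ n k (t : Vec ℤ k) → isLFib n k t ≡ inBlocks n t ∧ noSteps t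
isLFib-≡ n k t = cong₂ _∧_
  (all-tabulate (λ i → i) (λ i → inBlock n (toℕ i) (lookup t i)))
  (trans (all-tabulate (λ i → i) (λ i → all (noStepAt t i) (allFin k)))
         (allᶠ-cong (λ i → all-tabulate (λ j → j) (noStepAt t i))))

inBlock-suc : ∀ n j y → inBlock n (suc j) y ≡ inBlock n j (y - + n)
inBlock-suc n j y = cong₂ _∧_
  (trans (≤ᵇ-shift (+ (suc j *ℕ n +ℕ 1)) y (+ n))
         (cong (_≤ᵇ (y - + n)) (trans (cong (λ z → + z - + n) (ℕₚ.+-assoc n (j *ℕ n) 1))
                                      (+[m+n]-+m≡+n n (j *ℕ n +ℕ 1)))))
  (trans (≤ᵇ-shift y (+ (suc (suc j) *ℕ n)) (+ n))
         (cong ((y - + n) ≤ᵇ_) (+[m+n]-+m≡+n n (suc j *ℕ n))))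

inBlocks-∷ : ∀ n x (xs : Vec ℤ k) → inBlocks n (x ∷ xs) ≡ inBlock n 0 x ∧ inBlocks n (shiftDown n xs)
inBlocks-∷ n x xs = cong (inBlock n 0 x ∧_) (allᶠ-cong λ i →
  trans (inBlock-suc n (toℕ i) (lookup xs i))
        (cong (inBlock n (toℕ i)) (sym (Vecₚ.lookup-map i _ xs))))

==ℤ-+1-shift : ∀ n (x y : ℤ) → ((y - + n) ==ℤ ((x - + n) + 1ℤ)) ≡ (y ==ℤ (x + 1ℤ))
==ℤ-+1-shift n x y = T-injective (mk⇔
  (λ p → ≡⇒==ℤ (trans (sym (i-j+j≡i y (+ n)))
                 (trans (cong (_+ + n) (==ℤ⇒≡ p)) (shifted x (+ n)))))
  (λ p → ≡⇒==ℤ (trans (cong (_- + n) (==ℤ⇒≡ p)) (unshifted x (+ n)))))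
  where
  shifted : ∀ (a b : ℤ) → ((a - b) + 1ℤ) + b ≡ a + 1ℤ
  shifted = solve-∀
  unshifted : ∀ (a b : ℤ) → (a + 1ℤ) - b ≡ (a - b) + 1ℤ
  unshifted = solve-∀

noSteps-shiftDown : ∀ n (xs : Vec ℤ k) → noSteps xs ≡ noSteps (shiftDown n xs)
noSteps-shiftDown n xs = allᶠ-cong λ i → allᶠ-cong λ j → cong (not (toℕ j ≡ᵇ suc (toℕ i)) ∨_)
  (cong not (trans (sym (==ℤ-+1-shift n (lookup xs i) (lookup xs j)))
    (cong₂ (λ u v → u ==ℤ (v + 1ℤ)) (sym (Vecₚ.lookup-map j _ xs)) (sym (Vecₚ.lookup-map i _ xs)))))

-- Of the pairs of positions (0, j), only j = 1 is constrained.
noSteps-head : ∀ x (xs : Vec ℤ k) → allᶠ (noStepAt (x ∷ xs) zero ∘ suc) ≡ noStep x xs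
noSteps-head x []               = refl
noSteps-head {suc k} x (y ∷ ys) =
  trans (cong (not (y ==ℤ (x + 1ℤ)) ∧_) (allᶠ-true {k})) (∧-identityʳ _)

noSteps-∷ : ∀ n x (xs : Vec ℤ k) → noSteps (x ∷ xs) ≡ noStep x xs ∧ noSteps (shiftDown n xs)
noSteps-∷ n x xs = cong₂ _∧_ (noSteps-head x xs) (noSteps-shiftDown n xs)

isLFib-∷-≡ : ∀ n x (xs : Vec ℤ k) →
  isLFib n (suc k) (x ∷ xs) ≡ (inBlock n 0 x ∧ noStep x xs) ∧ isLFib n k (shiftDown n xs)
isLFib-∷-≡ {k} n x xs = begin
  isLFib n (suc k) (x ∷ xs)                          ≡⟨ isLFib-≡ n (suc k) (x ∷ xs) ⟩
  inBlocks n (x ∷ xs) ∧ noSteps (x ∷ xs)             ≡⟨ cong₂ _∧_ (inBlocks-∷ n x xs) (noSteps-∷ n x xs) ⟩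
  (inBlock n 0 x ∧ inBlocks n xs′) ∧ (noStep x xs ∧ noSteps xs′)
                                                     ≡⟨ ∧-interchange (inBlock n 0 x) _ (noStep x xs) _ ⟩
  (inBlock n 0 x ∧ noStep x xs) ∧ (inBlocks n xs′ ∧ noSteps xs′)
                                                     ≡⟨ cong ((inBlock n 0 x ∧ noStep x xs) ∧_) (sym (isLFib-≡ n k xs′)) ⟩
  (inBlock n 0 x ∧ noStep x xs) ∧ isLFib n k xs′     ∎
  where
  open ≡-Reasoning
  xs′ : Vec ℤ k
  xs′ = shiftDown n xs

record IsLFib∷ (n : ℕ) (x : ℤ) (xs : Vec ℤ k) : Set where
  constructor mkIsLFib∷
  field
    head-inBlock : T (inBlock n 0 x)
    head-noStep  : T (noStep x xs)
    tail-isLFib  : T (isLFib n k (shiftDown n xs))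

opaque
  isLFib-∷ : ∀ n x (xs : Vec ℤ k) → T (isLFib n (suc k) (x ∷ xs)) ⇔ IsLFib∷ n x xs
  isLFib-∷ n x xs = mk⇔
    (λ p → let bs , t = ∧-split (subst T (isLFib-∷-≡ n x xs) p)
               b  , s = ∧-split {inBlock n 0 x} bs
           in mkIsLFib∷ b s t)
    (λ { (mkIsLFib∷ b s t) → subst T (sym (isLFib-∷-≡ n x xs)) (∧-join (∧-join b s) t) })
    where
    ∧-split : ∀ {a b} → T (a ∧ b) → T a × T b
    ∧-split = Equivalence.to T-∧
    ∧-join : ∀ {a b} → T a → T b → T (a ∧ b)
    ∧-join p q = Equivalence.from T-∧ (p , q)

inBlock-0 : ∀ n x → T (inBlock n 0 x) → Σ ℕ λ j → x ≡ + suc j × j < n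
inBlock-0 n (+ zero)  ()
inBlock-0 n -[1+ _ ]  ()
inBlock-0 n (+ suc j) p =
  j , refl , subst (suc j ≤_) (ℕₚ.+-identityʳ n) (ℕₚ.≤ᵇ⇒≤ (suc j) (n +ℕ 0) p)

inBlock-0-entry : ∀ n j → j < n → T (inBlock n 0 (+ suc j))
inBlock-0-entry n j j<n = Equivalence.from T-∧
  ( ℤₚ.≤⇒≤ᵇ (+≤+ (s≤s (z≤n {j})))
  , ℤₚ.≤⇒≤ᵇ (+≤+ (subst (suc j ≤_) (sym (ℕₚ.+-identityʳ n)) j<n)))

sumVec-shiftDown : ∀ n (xs : Vec ℤ k) → sumVec (shiftDown n xs) ≡ sumVec xs - + (k *ℕ n)
sumVec-shiftDown n []                = refl
sumVec-shiftDown {suc k} n (y ∷ ys) = begin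
  (y - + n) + sumVec (shiftDown n ys)       ≡⟨ cong (λ z → (y - + n) + z) (sumVec-shiftDown n ys) ⟩
  (y - + n) + (sumVec ys - + (k *ℕ n))      ≡⟨ regroup y (+ n) (sumVec ys) (+ (k *ℕ n)) ⟩
  (y + sumVec ys) - (+ n + + (k *ℕ n))      ≡⟨ cong (λ z → (y + sumVec ys) - z) (sym (ℤₚ.pos-+ n (k *ℕ n))) ⟩
  (y + sumVec ys) - + (n +ℕ k *ℕ n)         ∎
  where
  open ≡-Reasoning
  regroup : ∀ (a b c d : ℤ) → (a - b) + (c - d) ≡ (a + c) - (b + d)
  regroup = solve-∀

-- The amount by which removing a first entry x changes the centered rank.
weight : ℕ → ℤ → ℤ
weight n x = (+ n + 1ℤ) - + 2 * x

rankCtr-∷ : ∀ n x (xs : Vec ℤ k) → rankCtr n (suc k) (x ∷ xs) ≡ rankCtr n k (shiftDown n xs) + weight n x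
rankCtr-∷ {k} n x xs = begin
  + (suc k *ℕ (suc k *ℕ n +ℕ 1)) - + 2 * (x + sumVec xs)
    ≡⟨ cong (_- + 2 * (x + sumVec xs)) (cast (suc k)) ⟩
  (1ℤ + + k) * ((1ℤ + + k) * + n + 1ℤ) - + 2 * (x + sumVec xs)
    ≡⟨ expand (+ k) (+ n) x (sumVec xs) (+ (k *ℕ n)) (ℤₚ.pos-* k n) ⟩
  (+ k * (+ k * + n + 1ℤ) - + 2 * (sumVec xs - + (k *ℕ n))) + weight n x
    ≡⟨ cong₂ (λ u v → (u - + 2 * v) + weight n x) (sym (cast k)) (sym (sumVec-shiftDown n xs)) ⟩
  rankCtr n k (shiftDown n xs) + weight n x
    ∎
  where
  open ≡-Reasoning
  cast : ∀ k → + (k *ℕ (k *ℕ n +ℕ 1)) ≡ + k * (+ k * + n + 1ℤ)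
  cast k = trans (ℤₚ.pos-* k _)
    (cong (+ k *_) (trans (ℤₚ.pos-+ (k *ℕ n) 1) (cong (_+ 1ℤ) (ℤₚ.pos-* k n))))
  expand′ : ∀ (K N x S : ℤ) → (1ℤ + K) * ((1ℤ + K) * N + 1ℤ) - + 2 * (x + S)
          ≡ (K * (K * N + 1ℤ) - + 2 * (S - K * N)) + ((N + 1ℤ) - + 2 * x)
  expand′ = solve-∀
  -- The ring solver takes no hypotheses, so the cast KN ≡ K * N is discharged by matching on refl.
  expand : ∀ (K N x S KN : ℤ) → KN ≡ K * N → (1ℤ + K) * ((1ℤ + K) * N + 1ℤ) - + 2 * (x + S)
         ≡ (K * (K * N + 1ℤ) - + 2 * (S - KN)) + ((N + 1ℤ) - + 2 * x)
  expand K N x S _ refl = expand′ K N x S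

rankCtr-single : ∀ n x → rankCtr n 1 (x ∷ []) ≡ weight n x
rankCtr-single n x = trans (rankCtr-∷ n x []) (ℤₚ.+-identityˡ (weight n x))

weight-injective : ∀ n {x y} → weight n x ≡ weight n y → x ≡ y
weight-injective n {x} {y} e = ℤₚ.*-cancelˡ-≡ (+ 2) x y (ℤₚ.neg-injective (+-cancelˡ-≡ (+ n + 1ℤ) e))

-- The list R_{n,k}

-- R-elem n k i is the i-th entry of Defs' list Rlist n k.
R-elem : ℕ → ℕ → ℕ → ℤ
R-elem n k i = - (+ (k *ℕ (n ∸ℕ 1))) + + (2 *ℕ i)

R-elem-injective : ∀ n k i j → R-elem n k i ≡ R-elem n k j → i ≡ j
R-elem-injective n k i j e = ℕₚ.*-cancelˡ-≡ i j 2 (ℤₚ.+-injective (+-cancelˡ-≡ (- (+ (k *ℕ (n ∸ℕ 1)))) e))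

any-applyUpTo : ∀ m (f : ℕ → ℤ) r →
  T (any (λ s → r ==ℤ s) (applyUpTo f m)) ⇔ Σ (Fin m) λ i → r ≡ f (toℕ i)
any-applyUpTo m f r = mk⇔ (find m f) (found m f)
  where
  find : ∀ m (f : ℕ → ℤ) → T (any (λ s → r ==ℤ s) (applyUpTo f m)) → Σ (Fin m) λ i → r ≡ f (toℕ i)
  find (suc m) f p with r ℤₚ.≟ f 0
  ... | yes r≡f0 = zero , r≡f0
  ... | no  _    = let i , r≡fi = find m (f ∘ suc) p in suc i , r≡fi
  found : ∀ m (f : ℕ → ℤ) → (Σ (Fin m) λ i → r ≡ f (toℕ i)) → T (any (λ s → r ==ℤ s) (applyUpTo f m))
  found (suc m) f (i , r≡fi) with r ℤₚ.≟ f 0 | i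
  ... | yes _    | _     = _
  ... | no  r≢f0 | zero  = ⊥-elim (r≢f0 r≡fi)
  ... | no  _    | suc i = found m (f ∘ suc) (i , r≡fi)

inR⇔ : ∀ n k r → T (inR n k r) ⇔ Σ (Fin (suc (k *ℕ (n ∸ℕ 1)))) λ i → r ≡ R-elem n k (toℕ i)
inR⇔ n k r = subst (λ l → T (any (λ s → r ==ℤ s) l) ⇔ (Σ (Fin (suc (k *ℕ (n ∸ℕ 1)))) λ i → r ≡ R-elem n k (toℕ i)))
                   (sym (Listₚ.map-upTo (R-elem n k) (suc (k *ℕ (n ∸ℕ 1)))))
                   (any-applyUpTo (suc (k *ℕ (n ∸ℕ 1))) (R-elem n k) r)

inR↔Fin : ∀ n k → Σ ℤ (T ∘ inR n k) ↔ Fin (suc (k *ℕ (n ∸ℕ 1)))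
inR↔Fin n k = mk↔ₛ′ to′ from′ to∘from from∘to
  where
  open Equivalence
  to′ : Σ ℤ (T ∘ inR n k) → Fin (suc (k *ℕ (n ∸ℕ 1)))
  to′ (s , p) = proj₁ (to (inR⇔ n k s) p)
  from′ : Fin (suc (k *ℕ (n ∸ℕ 1))) → Σ ℤ (T ∘ inR n k)
  from′ i = R-elem n k (toℕ i) , from (inR⇔ n k _) (i , refl)
  to∘from : ∀ i → to′ (from′ i) ≡ i
  to∘from i = Finₚ.toℕ-injective (sym (R-elem-injective n k _ _ (proj₂ (to (inR⇔ n k _) (from (inR⇔ n k _) (i , refl))))))
  from∘to : ∀ s → from′ (to′ s) ≡ s
  from∘to (s , p) = T-Σ-≡ (sym (proj₂ (to (inR⇔ n k s) p)))

Σ-inR↔ : ∀ n k (P : ℤ → Set) → Σ (Σ ℤ (T ∘ inR n k)) (P ∘ proj₁) ↔ Σ (Fin (suc (k *ℕ (n ∸ℕ 1)))) (P ∘ R-elem n k ∘ toℕ)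
Σ-inR↔ n k P = Σ-↔ (inR↔Fin n k) (λ {(s , p)} → subst-↔ (proj₂ (Equivalence.to (inR⇔ n k s) p)))
  where
  subst-↔ : ∀ {x y} → x ≡ y → P x ↔ P y
  subst-↔ refl = ↔-refl

sumℤ-applyUpTo : ∀ m (f : ℕ → ℤ) (g : ℕ → ℕ) → (∀ j → f j ≡ + g j) → sumℤ (applyUpTo f m) ≡ + sumᶠ {m} (g ∘ toℕ)
sumℤ-applyUpTo zero    f g f≡g = refl
sumℤ-applyUpTo (suc m) f g f≡g = cong₂ _+_ (f≡g 0) (sumℤ-applyUpTo m (f ∘ suc) (g ∘ suc) (f≡g ∘ suc))

sumℤ-Rlist : ∀ n k (f : ℤ → ℤ) (g : ℕ → ℕ) → (∀ j → f (R-elem n k j) ≡ + g j) →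
  sumℤ (map f (Rlist n k)) ≡ + sumᶠ {suc (k *ℕ (n ∸ℕ 1))} (g ∘ toℕ)
sumℤ-Rlist n k f g f≡g =
  trans (cong sumℤ (trans (sym (Listₚ.map-∘ {g = f} {f = R-elem n k} (upTo len))) (Listₚ.map-upTo (f ∘ R-elem n k) len)))
        (sumℤ-applyUpTo len (f ∘ R-elem n k) g f≡g)
  where
  len : ℕ
  len = suc (k *ℕ (n ∸ℕ 1))

R-elem-+-weight : ∀ n0 k i j → j ≤ n0 →
  R-elem (suc n0) k i + weight (suc n0) (+ suc j) ≡ R-elem (suc n0) (suc k) (i +ℕ (n0 ∸ℕ j))
R-elem-+-weight n0 k i j j≤n0 = begin
  (- + K + + (2 *ℕ i)) + weight (suc n0) (+ suc j)
    ≡⟨ cong (λ a → (- + K + a) + weight (suc n0) (+ suc j)) (ℤₚ.pos-* 2 i) ⟩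
  (- + K + + 2 * + i) + weight (suc n0) (+ suc j)
    ≡⟨ regroup (+ K) (+ i) (+ j) (+ (n0 ∸ℕ j)) (+ n0) (cong +_ (sym (ℕₚ.m+[n∸m]≡n j≤n0))) ⟩
  - + (n0 +ℕ K) + + 2 * (+ i + + (n0 ∸ℕ j))
    ≡⟨ cong (λ a → - + (n0 +ℕ K) + a) (sym (ℤₚ.pos-* 2 (i +ℕ (n0 ∸ℕ j)))) ⟩
  - + (n0 +ℕ K) + + (2 *ℕ (i +ℕ (n0 ∸ℕ j)))
    ∎
  where
  open ≡-Reasoning
  K : ℕ
  K = k *ℕ n0
  regroup′ : ∀ (K i j d : ℤ) → (- K + + 2 * i) + (((1ℤ + (j + d)) + 1ℤ) - + 2 * (1ℤ + j))
           ≡ - ((j + d) + K) + + 2 * (i + d)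
  regroup′ = solve-∀
  regroup : ∀ (K i j d N : ℤ) → N ≡ j + d → (- K + + 2 * i) + (((1ℤ + N) + 1ℤ) - + 2 * (1ℤ + j))
          ≡ - (N + K) + + 2 * (i + d)
  regroup K i j d _ refl = regroup′ K i j d

rankCtr-R-elem : ∀ n0 k (t : Vec ℤ k) → T (isLFib (suc n0) k t) →
  Σ (Fin (suc (k *ℕ n0))) λ i → rankCtr (suc n0) k t ≡ R-elem (suc n0) k (toℕ i)
rankCtr-R-elem n0 zero    []       _ = zero , refl
rankCtr-R-elem n0 (suc k) (x ∷ xs) p
  with mkIsLFib∷ x∈B₀ _ xs∈L ← Equivalence.to (isLFib-∷ (suc n0) x xs) p
  with i , rank≡ ← rankCtr-R-elem n0 k (shiftDown (suc n0) xs) xs∈L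
     | j , refl , s≤s j≤n0 ← inBlock-0 (suc n0) x x∈B₀
  = fromℕ< i′<bound , (begin
    rankCtr (suc n0) (suc k) (+ suc j ∷ xs)
      ≡⟨ rankCtr-∷ (suc n0) (+ suc j) xs ⟩
    rankCtr (suc n0) k (shiftDown (suc n0) xs) + weight (suc n0) (+ suc j)
      ≡⟨ cong (_+ weight (suc n0) (+ suc j)) rank≡ ⟩
    R-elem (suc n0) k (toℕ i) + weight (suc n0) (+ suc j)
      ≡⟨ R-elem-+-weight n0 k (toℕ i) j j≤n0 ⟩
    R-elem (suc n0) (suc k) i′
      ≡⟨ cong (R-elem (suc n0) (suc k)) (sym (Finₚ.toℕ-fromℕ< i′<bound)) ⟩
    R-elem (suc n0) (suc k) (toℕ (fromℕ< i′<bound))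
      ∎)
  where
  open ≡-Reasoning
  i′ : ℕ
  i′ = toℕ i +ℕ (n0 ∸ℕ j)
  i′<bound : i′ < suc (n0 +ℕ k *ℕ n0)
  i′<bound = s≤s (subst (_≤ n0 +ℕ k *ℕ n0) (ℕₚ.+-comm (n0 ∸ℕ j) (toℕ i))
                   (ℕₚ.+-mono-≤ (ℕₚ.m∸n≤m n0 j) (ℕₚ.≤-pred (Finₚ.toℕ<n i))))

rankCtr-inR : ∀ n0 k (t : Vec ℤ k) → T (isLFib (suc n0) k t) → T (inR (suc n0) k (rankCtr (suc n0) k t))
rankCtr-inR n0 k t p = Equivalence.from (inR⇔ (suc n0) k _) (rankCtr-R-elem n0 k t p)

C-≡ : ∀ {n k r} {c c′ : C n k r} → proj₁ c ≡ proj₁ c′ → c ≡ c′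
C-≡ = T-Σ-≡

C-isLFib : ∀ {n k r} (c : C n k r) → T (isLFib n k (proj₁ c))
C-isLFib {n} {k} {r} (t , p) = proj₁ (Equivalence.to T-∧ (proj₂ (Equivalence.to (T-∧ {inR n k r}) p)))

C-inR : ∀ {n k r} (c : C n k r) → T (inR n k r)
C-inR {n} {k} {r} (t , p) = proj₁ (Equivalence.to (T-∧ {inR n k r}) p)

C-empty↔ : ∀ {n k r} → inR n k r ≡ false → C n k r ↔ Fin 0
C-empty↔ {n} {k} {r} r∉R = mk↔ₛ′ (λ c → ⊥-elim (∉ c)) (λ ()) (λ ()) (λ c → ⊥-elim (∉ c))
  where
  ∉ : C n k r → ⊥
  ∉ c = subst T r∉R (C-inR {n} {k} {r} c)

C-rank : ∀ {n k r} (c : C n k r) → rankCtr n k (proj₁ c) ≡ r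
C-rank {n} {k} {r} (t , p) =
  ==ℤ⇒≡ (proj₂ (Equivalence.to (T-∧ {isLFib n k t}) (proj₂ (Equivalence.to (T-∧ {inR n k r}) p))))

-- Opaque, like isLFib-∷: elements of C are compared through their tuples, and letting the
-- conversion checker unfold these proofs makes the bijection below very slow to check.
opaque
  C-proof : ∀ n0 {k} r (t : Vec ℤ k) → T (isLFib (suc n0) k t) → rankCtr (suc n0) k t ≡ r →
            T (inR (suc n0) k r ∧ (isLFib (suc n0) k t ∧ (rankCtr (suc n0) k t ==ℤ r)))
  C-proof n0 {k} r t t∈L rank≡r = Equivalence.from T-∧
      (subst (T ∘ inR (suc n0) k) rank≡r (rankCtr-inR n0 k t t∈L) , Equivalence.from T-∧ (t∈L , ≡⇒==ℤ rank≡r))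

mkC : ∀ n0 {k} r (t : Vec ℤ k) → T (isLFib (suc n0) k t) → rankCtr (suc n0) k t ≡ r → C (suc n0) k r
mkC n0 r t t∈L rank≡r = t , C-proof n0 r t t∈L rank≡r

a-outside : ∀ n k r → inR n (suc (suc k)) r ≡ false → a n (suc (suc k)) r ≡ 0ℤ
a-outside n k r r∉R =
  cong (λ b → if b then sumℤ (map (λ s → a n (suc k) (r + s)) (Rlist n 1)) - a n k r else 0ℤ) r∉R

a-inside : ∀ n k r → inR n (suc (suc k)) r ≡ true →
  a n (suc (suc k)) r ≡ sumℤ (map (λ s → a n (suc k) (r + s)) (Rlist n 1)) - a n k r
a-inside n k r r∈R =
  cong (λ b → if b then sumℤ (map (λ s → a n (suc k) (r + s)) (Rlist n 1)) - a n k r else 0ℤ) r∈R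

-- Decomposition by the first entry, for n ≥ 2

module FirstEntry (n1 : ℕ) where

  n0 n : ℕ
  n0 = suc n1
  n  = suc n0

  lastIdx : Fin n
  lastIdx = fromℕ n0

  -- Removing a first entry `entry i` raises the centered rank by σ i ∈ R_{n,1}.
  entry : Fin n → ℤ
  entry i = + suc (toℕ i)

  σ : Fin n → ℤ
  σ i = R-elem n 1 (toℕ i)

  weight-entry : ∀ j → weight n (+ suc j) + R-elem n 1 j ≡ 0ℤ
  weight-entry j = trans (cong (λ z → weight n (+ suc j) + (- + (n0 +ℕ 0) + z)) (ℤₚ.pos-* 2 j))
                         (cancel (+ n0) (+ j))
    where
    cancel : ∀ (N J : ℤ) → (((1ℤ + N) + 1ℤ) - + 2 * (1ℤ + J)) + (- (N + + 0) + + 2 * J) ≡ 0ℤ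
    cancel = solve-∀

  weight-one : weight n 1ℤ ≡ σ lastIdx
  weight-one = begin
    weight n 1ℤ                                   ≡⟨ expand (+ n0) ⟩
    - + (n0 +ℕ 0) + + 2 * + n0                    ≡⟨ cong (λ j → - + (n0 +ℕ 0) + + 2 * + j) (sym (Finₚ.toℕ-fromℕ n0)) ⟩
    - + (n0 +ℕ 0) + + 2 * + toℕ lastIdx           ≡⟨ cong (λ z → - + (n0 +ℕ 0) + z) (sym (ℤₚ.pos-* 2 (toℕ lastIdx))) ⟩
    σ lastIdx                                     ∎
    where
    open ≡-Reasoning
    expand : ∀ (N : ℤ) → ((1ℤ + N) + 1ℤ) - + 2 * + 1 ≡ - (N + + 0) + + 2 * N
    expand = solve-∀

  rankCtr-behead : ∀ {k} r {s} x (xs : Vec ℤ k) → weight n x + s ≡ 0ℤ →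
    (rankCtr n (suc k) (x ∷ xs) ≡ r) ⇔ (rankCtr n k (shiftDown n xs) ≡ r + s)
  rankCtr-behead r x xs w+s≡0 = mk⇔
    (λ e → Equivalence.to (+-transpose w+s≡0) (trans (sym (rankCtr-∷ n x xs)) e))
    (λ e → trans (rankCtr-∷ n x xs) (Equivalence.from (+-transpose w+s≡0) e))

  valid : ∀ {k} r (c : C n k r) → T (isLFib n k (proj₁ c))
  valid r = C-isLFib {n} {_} {r}

  rank : ∀ {k} r (c : C n k r) → rankCtr n k (proj₁ c) ≡ r
  rank r = C-rank {n} {_} {r}

  head : ∀ {k} {P : Vec ℤ (suc k) → Set} → Σ (Vec ℤ (suc k)) P → ℤ
  head c = Vec.head (proj₁ c)

  tail : ∀ {k} {P : Vec ℤ (suc k) → Set} → Σ (Vec ℤ (suc k)) P → Vec ℤ k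
  tail c = Vec.tail (proj₁ c)

  cons-view : ∀ {k} r (c : C n (suc k) r) → IsLFib∷ n (head c) (tail c)
  cons-view r c@(x ∷ xs , _) = Equivalence.to (isLFib-∷ n x xs) (valid r c)

  headIdx : ∀ {k} r → C n (suc k) r → Fin n
  headIdx r c = fromℕ< (proj₂ (proj₂ J))
    where
    J : Σ ℕ λ j → head c ≡ + suc j × j < n
    J = inBlock-0 n (head c) (IsLFib∷.head-inBlock (cons-view r c))

  entry-headIdx : ∀ {k} r (c : C n (suc k) r) → entry (headIdx r c) ≡ head c
  entry-headIdx r c = trans (cong (+_ ∘ suc) (Finₚ.toℕ-fromℕ< (proj₂ (proj₂ J)))) (sym (proj₁ (proj₂ J)))
    where
    J : Σ ℕ λ j → head c ≡ + suc j × j < n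
    J = inBlock-0 n (head c) (IsLFib∷.head-inBlock (cons-view r c))

  entry-injective : ∀ {i i′ : Fin n} → entry i ≡ entry i′ → i ≡ i′
  entry-injective e = Finₚ.toℕ-injective (ℕₚ.suc-injective (ℤₚ.+-injective e))

  -- C′ k r is C_r(n, k − 1), empty for k = 0.
  C′ : ℕ → ℤ → Set
  C′ zero    r = ⊥
  C′ (suc k) r = C n k r

  Left Right : ℕ → ℤ → Set
  Left  k r = C n (suc k) r ⊎ C′ k r
  Right k r = Σ (Fin n) λ i → C n k (r + σ i)

  Right-≡ : ∀ {k r} {i i′ : Fin n} {c : C n k (r + σ i)} {c′ : C n k (r + σ i′)} →
            toℕ i ≡ toℕ i′ → proj₁ c ≡ proj₁ c′ → _≡_ {A = Right k r} (i , c) (i′ , c′)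
  Right-≡ {k} {r} {i} e e′ with Finₚ.toℕ-injective e
  ... | refl = cong (i ,_) (C-≡ {n} {k} {r + σ i} e′)

  behead : ∀ {k} r → C n (suc k) r → Right k r
  behead r c@(x ∷ xs , _) = i , mkC n0 (r + σ i) (shiftDown n xs) (IsLFib∷.tail-isLFib (cons-view r c))
    (Equivalence.to (rankCtr-behead r x xs w+σ≡0) (rank r c))
    where
    i : Fin n
    i = headIdx r c
    w+σ≡0 : weight n x + σ i ≡ 0ℤ
    w+σ≡0 = subst (λ y → weight n y + σ i ≡ 0ℤ) (entry-headIdx r c) (weight-entry (toℕ i))

  prepend : ∀ {k} r (i : Fin n) (c : C n k (r + σ i)) → T (noStep (entry i) (shiftUp n (proj₁ c))) → C n (suc k) r
  prepend {k} r i c@(v , _) noStep-i = mkC n0 r (entry i ∷ shiftUp n v)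
    (Equivalence.from (isLFib-∷ n (entry i) (shiftUp n v)) (mkIsLFib∷ (inBlock-0-entry n _ (Finₚ.toℕ<n i)) noStep-i
      (subst (T ∘ isLFib n k) (sym (shiftDown-shiftUp n v)) (valid (r + σ i) c))))
    (Equivalence.from (rankCtr-behead r (entry i) (shiftUp n v) (weight-entry (toℕ i)))
      (subst (λ t → rankCtr n k t ≡ r + σ i) (sym (shiftDown-shiftUp n v)) (rank (r + σ i) c)))

  behead-prepend : ∀ {k} r i (c : C n k (r + σ i)) (p : T (noStep (entry i) (shiftUp n (proj₁ c)))) →
    behead r (prepend r i c p) ≡ (i , c)
  behead-prepend r i c@(v , _) p =
    Right-≡ {r = r} (cong toℕ (entry-injective (entry-headIdx r (prepend r i c p)))) (shiftDown-shiftUp n v)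

  prepend-behead : ∀ {k} r (c : C n (suc k) r) →
    (p : T (noStep (entry (proj₁ (behead r c))) (shiftUp n (proj₁ (proj₂ (behead r c)))))) →
    prepend r (proj₁ (behead r c)) (proj₂ (behead r c)) p ≡ c
  prepend-behead {k} r c@(x ∷ xs , _) p = C-≡ {n} {suc k} {r} (cong₂ _∷_ (entry-headIdx r c) (shiftUp-shiftDown n xs))

  -- This is where n ≥ 2 is used: a raised tuple starts at n + 1 ≠ 2.
  noStep-one-shiftUp : ∀ {k} (v : Vec ℤ k) → T (isLFib n k v) → T (noStep 1ℤ (shiftUp n v))
  noStep-one-shiftUp []       _    = _
  noStep-one-shiftUp (y ∷ ys) v∈L with inBlock-0 n y (IsLFib∷.head-inBlock (Equivalence.to (isLFib-∷ n y ys) v∈L))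
  ... | a , refl , _ = ≢⇒not-==ℤ λ e → a+n≢1 (ℕₚ.suc-injective (ℤₚ.+-injective e))
    where
    a+n≢1 : a +ℕ n ≢ 1
    a+n≢1 e with ℕₚ.m+n≡0⇒n≡0 a (ℕₚ.suc-injective (trans (sym (ℕₚ.+-suc a n0)) e))
    ... | ()

  prepend-one : ∀ {k} r → C n k r → C n (suc k) (r + σ lastIdx)
  prepend-one {k} r c@(v , _) = mkC n0 (r + σ lastIdx) (1ℤ ∷ shiftUp n v)
    (Equivalence.from (isLFib-∷ n 1ℤ (shiftUp n v)) (mkIsLFib∷ (inBlock-0-entry n 0 (s≤s z≤n))
      (noStep-one-shiftUp v (valid r c))
      (subst (T ∘ isLFib n k) (sym (shiftDown-shiftUp n v)) (valid r c))))
    (begin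
      rankCtr n (suc k) (1ℤ ∷ shiftUp n v)              ≡⟨ rankCtr-∷ n 1ℤ (shiftUp n v) ⟩
      rankCtr n k (shiftDown n (shiftUp n v)) + weight n 1ℤ
                                                       ≡⟨ cong₂ (λ t w → rankCtr n k t + w) (shiftDown-shiftUp n v) weight-one ⟩
      rankCtr n k v + σ lastIdx                        ≡⟨ cong (_+ σ lastIdx) (rank r c) ⟩
      r + σ lastIdx                                    ∎)
    where open ≡-Reasoning

  step⇒last-oneℕ : ∀ a j → j ≤ n0 → suc a +ℕ n ≡ suc j +ℕ 1 → a ≡ 0 × j ≡ n0
  step⇒last-oneℕ zero    j j≤n0 e = refl , sym (ℕₚ.suc-injective (trans (ℕₚ.suc-injective e) (ℕₚ.+-comm j 1)))
  step⇒last-oneℕ (suc a) j j≤n0 e = ⊥-elim (ℕₚ.1+n≰n (begin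
    suc n       ≤⟨ s≤s (ℕₚ.m≤n+m n a) ⟩
    suc a +ℕ n  ≡⟨ ℕₚ.suc-injective e ⟩
    j +ℕ 1      ≡⟨ ℕₚ.+-comm j 1 ⟩
    suc j       ≤⟨ s≤s j≤n0 ⟩
    n           ∎))
    where open ℕₚ.≤-Reasoning

  step⇒last-one : ∀ {k} s (i : Fin n) (c : C n (suc k) s) → head c + + n ≡ entry i + 1ℤ → toℕ i ≡ n0 × head c ≡ 1ℤ
  step⇒last-one s i c e with inBlock-0 n (head c) (IsLFib∷.head-inBlock (cons-view s c))
  ... | a , x≡ , _ with step⇒last-oneℕ a (toℕ i) (ℕₚ.≤-pred (Finₚ.toℕ<n i))
                          (ℤₚ.+-injective (trans (cong (_+ + n) (sym x≡)) e))
  ...   | refl , i≡n0 = i≡n0 , x≡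

  drop-one : ∀ {k} r (i : Fin n) (c : C n (suc k) (r + σ i)) → toℕ i ≡ n0 × head c ≡ 1ℤ → C n k r
  drop-one {k} r i c@(y ∷ ys , _) (i≡n0 , y≡1) = mkC n0 r (shiftDown n ys) (IsLFib∷.tail-isLFib (cons-view (r + σ i) c))
    (+-cancelʳ-≡ (begin
      rankCtr n k (shiftDown n ys) + weight n 1ℤ       ≡⟨ cong (λ z → rankCtr n k (shiftDown n ys) + weight n z) (sym y≡1) ⟩
      rankCtr n k (shiftDown n ys) + weight n y        ≡⟨ sym (rankCtr-∷ n y ys) ⟩
      rankCtr n (suc k) (y ∷ ys)                       ≡⟨ rank (r + σ i) c ⟩
      r + σ i                                          ≡⟨ cong (λ j → r + R-elem n 1 j) (trans i≡n0 (sym (Finₚ.toℕ-fromℕ n0))) ⟩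
      r + σ lastIdx                                    ≡⟨ cong (λ z → r + z) (sym weight-one) ⟩
      r + weight n 1ℤ                                  ∎))
    where open ≡-Reasoning

  decompose : ∀ {k} r → Left k r → Right k r
  decompose r (inj₁ c) = behead r c
  decompose {suc k} r (inj₂ c) = lastIdx , prepend-one r c

  recompose∷ : ∀ {k} r (i : Fin n) (c : C n (suc k) (r + σ i)) (b : Bool) →
            ((head c + + n) ==ℤ (entry i + 1ℤ)) ≡ b → Left (suc k) r
  recompose∷ r i c@(_ ∷ _ , _) false h = inj₁ (prepend r i c (subst (T ∘ not) (sym h) _))
  recompose∷ r i c@(_ ∷ _ , _) true  h = inj₂ (drop-one r i c (step⇒last-one (r + σ i) i c (==ℤ⇒≡ (subst T (sym h) _))))

  recompose : ∀ {k} r → Right k r → Left k r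
  recompose r (i , c@([] , _))    = inj₁ (prepend r i c _)
  recompose r (i , c@(_ ∷ _ , _)) = recompose∷ r i c _ refl

  recompose∷-noStep : ∀ {k} r i (c : C n (suc k) (r + σ i)) (p : T (noStep (entry i) (shiftUp n (proj₁ c)))) b h →
                   recompose∷ r i c b h ≡ inj₁ (prepend r i c p)
  recompose∷-noStep r i c@(_ ∷ _ , _) p false h = cong (inj₁ ∘ prepend r i c) (T-irrelevant _ _)
  recompose∷-noStep r i c@(_ ∷ _ , _) p true  h = ⊥-elim (subst (T ∘ not) h p)

  recompose∷-step : ∀ {k} r i (c : C n (suc k) (r + σ i)) → T ((head c + + n) ==ℤ (entry i + 1ℤ)) → ∀ b h →
                 (c′ : C n k r) → proj₁ c′ ≡ shiftDown n (tail c) → recompose∷ r i c b h ≡ inj₂ c′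
  recompose∷-step {k} r i c@(_ ∷ _ , _) step false h c′ e = ⊥-elim (subst T h step)
  recompose∷-step {k} r i c@(_ ∷ _ , _) step true  h c′ e = cong inj₂ (C-≡ {n} {k} {r} (sym e))

  decompose-recompose∷ : ∀ {k} r i (c : C n (suc k) (r + σ i)) b h → decompose r (recompose∷ r i c b h) ≡ (i , c)
  decompose-recompose∷ r i c@(_ ∷ _ , _) false h = behead-prepend r i c _
  decompose-recompose∷ r i c@(y ∷ ys , _) true h =
    Right-≡ {r = r} (trans (Finₚ.toℕ-fromℕ n0) (sym (proj₁ forced))) (cong₂ _∷_ (sym (proj₂ forced)) (shiftUp-shiftDown n ys))
    where
    forced : toℕ i ≡ n0 × y ≡ 1ℤ
    forced = step⇒last-one (r + σ i) i c (==ℤ⇒≡ (subst T (sym h) _))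

  decompose-recompose : ∀ {k} r (y : Right k r) → decompose r (recompose r y) ≡ y
  decompose-recompose r (i , c@([] , _))    = behead-prepend r i c _
  decompose-recompose r (i , c@(_ ∷ _ , _)) = decompose-recompose∷ r i c _ refl

  recompose-decompose-∷ : ∀ {k} r (c : C n (suc (suc k)) r) → recompose r (decompose r (inj₁ c)) ≡ inj₁ c
  recompose-decompose-∷ r c@(x ∷ y ∷ ys , _) =
    trans (recompose∷-noStep r (proj₁ (behead r c)) (proj₂ (behead r c)) noStep-head _ refl)
          (cong inj₁ (prepend-behead r c noStep-head))
    where
    noStep-head : T (noStep (entry (proj₁ (behead r c))) (shiftUp n (shiftDown n (y ∷ ys))))
    noStep-head = subst₂ (λ a v → T (noStep a v)) (sym (entry-headIdx r c)) (sym (shiftUp-shiftDown n (y ∷ ys)))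
                         (IsLFib∷.head-noStep (cons-view r c))

  recompose-decompose-one : ∀ {k} r (c : C n k r) → recompose r (decompose r (inj₂ c)) ≡ inj₂ c
  recompose-decompose-one r c@(v , _) =
    recompose∷-step r lastIdx (prepend-one r c) (≡⇒==ℤ {1ℤ + + n} {entry lastIdx + 1ℤ} step) _ refl c (sym (shiftDown-shiftUp n v))
    where
    step : 1ℤ + + n ≡ entry lastIdx + 1ℤ
    step = trans (cong (λ m → + suc m) (ℕₚ.+-comm 1 n0)) (cong (λ j → + (suc j +ℕ 1)) (sym (Finₚ.toℕ-fromℕ n0)))

  recompose-decompose-single : ∀ r (c : C n 1 r) → recompose r (decompose r (inj₁ c)) ≡ inj₁ c
  recompose-decompose-single r c@(_ ∷ [] , _) = cong inj₁ (prepend-behead r c _)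

  recompose-decompose : ∀ {k} r (x : Left k r) → recompose r (decompose r x) ≡ x
  recompose-decompose {zero}  r (inj₁ c) = recompose-decompose-single r c
  recompose-decompose {suc k} r (inj₁ c) = recompose-decompose-∷ r c
  recompose-decompose {suc k} r (inj₂ c) = recompose-decompose-one r c

  first-entry↔ : ∀ k r → Left k r ↔ Right k r
  first-entry↔ k r = mk↔ₛ′ (decompose r) (recompose r) (decompose-recompose r) (recompose-decompose r)

  R₁-reindex↔ : ∀ k r → Σ (Σ ℤ (T ∘ inR n 1)) (λ s → C n k (r + proj₁ s)) ↔ Right k r
  R₁-reindex↔ k r = ↔-trans (Σ-inR↔ n 1 (λ s → C n k (r + s)))
                            (Σ-Fin-cast↔ (cong suc (ℕₚ.*-identityˡ n0)) (λ j → C n k (r + R-elem n 1 j)))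

  Count : ℕ → Set
  Count k = ∀ r → Σ ℕ λ m → (C n k r ↔ Fin m) × (+ m ≡ a n k r)

  count₀ : Count 0
  count₀ r = indicator (r ==ℤ 0ℤ) , subsingleton↔Fin-indicator _ unique intro elim , +-indicator _
    where
    unique : (c c′ : C n 0 r) → c ≡ c′
    unique ([] , _) ([] , _) = C-≡ {n} {0} {r} refl
    intro : T (r ==ℤ 0ℤ) → C n 0 r
    intro r≡0 = mkC n0 r [] _ (sym (==ℤ⇒≡ r≡0))
    elim : C n 0 r → T (r ==ℤ 0ℤ)
    elim c@([] , _) = ≡⇒==ℤ (sym (rank r c))

  weight-reflect : ∀ j → j ≤ n0 → weight n (+ suc (n0 ∸ℕ j)) ≡ R-elem n 1 j
  weight-reflect j j≤n0 =
    trans (identity (+ (n0 ∸ℕ j)) (+ j) (+ n0) (cong +_ (sym (ℕₚ.m∸n+n≡m j≤n0))))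
          (cong (λ z → - + (n0 +ℕ 0) + z) (sym (ℤₚ.pos-* 2 j)))
    where
    identity′ : ∀ (D J : ℤ) → ((1ℤ + (D + J)) + 1ℤ) - + 2 * (1ℤ + D) ≡ - ((D + J) + + 0) + + 2 * J
    identity′ = solve-∀
    identity : ∀ D J N → N ≡ D + J → ((1ℤ + N) + 1ℤ) - + 2 * (1ℤ + D) ≡ - (N + + 0) + + 2 * J
    identity D J _ refl = identity′ D J

  count₁ : Count 1
  count₁ r = indicator (inR n 1 r) , subsingleton↔Fin-indicator _ unique intro (C-inR {n} {1} {r}) , +-indicator _
    where
    unique : (c c′ : C n 1 r) → c ≡ c′
    unique c@(x ∷ [] , _) c′@(x′ ∷ [] , _) = C-≡ {n} {1} {r} (cong (_∷ [])
      (weight-injective n (trans (sym (rankCtr-single n x)) (trans (rank r c) (trans (sym (rank r c′)) (rankCtr-single n x′))))))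
    intro : T (inR n 1 r) → C n 1 r
    intro r∈R = mkC n0 r (x ∷ []) x-valid (trans (rankCtr-single n x) (trans (weight-reflect j j≤n0) (sym (proj₂ index))))
      where
      index : Σ (Fin (suc (1 *ℕ n0))) λ i → r ≡ R-elem n 1 (toℕ i)
      index = Equivalence.to (inR⇔ n 1 r) r∈R
      j : ℕ
      j = toℕ (proj₁ index)
      j≤n0 : j ≤ n0
      j≤n0 = subst (j ≤_) (ℕₚ.*-identityˡ n0) (ℕₚ.≤-pred (Finₚ.toℕ<n (proj₁ index)))
      x : ℤ
      x = + suc (n0 ∸ℕ j)
      x-valid : T (isLFib n 1 (x ∷ []))
      x-valid = Equivalence.from (isLFib-∷ n x []) (mkIsLFib∷ (inBlock-0-entry n _ (s≤s (ℕₚ.m∸n≤m n0 j))) _ _)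

  count-recurrence : ∀ k → Count k → Count (suc k) → ∀ r → Σ ℕ λ m → (C n (suc (suc k)) r ↔ Fin m) ×
                     (+ m ≡ sumℤ (map (λ s → a n (suc k) (r + s)) (Rlist n 1)) - a n k r)
  count-recurrence k count-k count-k+1 r = m₂ , proj₁ (proj₂ cancelled) , (begin
    + m₂                             ≡⟨ sym (i+j-j≡i (+ m₂) (+ m₀)) ⟩
    (+ m₂ + + m₀) - + m₀             ≡⟨ cong (λ z → + z - + m₀) (proj₂ (proj₂ cancelled)) ⟩
    + sumᶠ {n} (M ∘ toℕ) - + m₀      ≡⟨ cong₂ _-_ (sym sum≡) (proj₂ (proj₂ (count-k r))) ⟩
    sumℤ (map (λ s → a n (suc k) (r + s)) (Rlist n 1)) - a n k r ∎)
    where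
    open ≡-Reasoning
    M : ℕ → ℕ
    M j = proj₁ (count-k+1 (r + R-elem n 1 j))
    m₀ : ℕ
    m₀ = proj₁ (count-k r)
    cancelled : Σ ℕ λ l → (C n (suc (suc k)) r ↔ Fin l) × (l +ℕ m₀ ≡ sumᶠ {n} (M ∘ toℕ))
    cancelled = ⊎-cancelʳ-Fin
      (↔-trans (first-entry↔ (suc k) r)
        (↔-trans (Σ-↔ ↔-refl (λ {i} → proj₁ (proj₂ (count-k+1 (r + σ i))))) (Σ-Fin↔sumᶠ (M ∘ toℕ))))
      (proj₁ (proj₂ (count-k r)))
    m₂ : ℕ
    m₂ = proj₁ cancelled
    sum≡ : sumℤ (map (λ s → a n (suc k) (r + s)) (Rlist n 1)) ≡ + sumᶠ {n} (M ∘ toℕ)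
    sum≡ = trans (sumℤ-Rlist n 1 (λ s → a n (suc k) (r + s)) M (λ j → sym (proj₂ (proj₂ (count-k+1 (r + R-elem n 1 j))))))
                 (cong (λ l → + sumᶠ {l} (M ∘ toℕ)) (cong suc (ℕₚ.*-identityˡ n0)))

  count-step : ∀ k → Count k → Count (suc k) → Count (suc (suc k))
  count-step k count-k count-k+1 r = by-membership _ refl
    where
    by-membership : ∀ b → inR n (suc (suc k)) r ≡ b → Σ ℕ λ m → (C n (suc (suc k)) r ↔ Fin m) × (+ m ≡ a n (suc (suc k)) r)
    by-membership false r∉R = 0 , C-empty↔ {n} {suc (suc k)} {r} r∉R , sym (a-outside n k r r∉R)
    by-membership true  r∈R = let m , C↔Fin-m , m≡ = count-recurrence k count-k count-k+1 r
                              in m , C↔Fin-m , trans m≡ (sym (a-inside n k r r∈R))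

  counts : ∀ k → Count k × Count (suc k)
  counts zero    = count₀ , count₁
  counts (suc k) = proj₂ (counts k) , count-step k (proj₁ (counts k)) (proj₂ (counts k))

proposition2p1 : (n k : ℕ) → 2 ≤ n → 1 ≤ k → (r : ℤ) →
    ((Cℤ n (+ k) r ⊎ Cℤ n (+ k - + 2) r)
       ↔ Σ (Σ ℤ (λ s → T (inR n 1 s))) (λ s → Cℤ n (+ k - + 1) (r + proj₁ s)))
    × Σ ℕ (λ m → (C n k r ↔ Fin m) × (+ m ≡ a n k r))
proposition2p1 (suc (suc n1)) (suc k) (s≤s (s≤s z≤n)) (s≤s z≤n) r = recurrence k , proj₁ (counts (suc k)) r
  where
  open FirstEntry n1
  -- Cℤ n (+ (k + 1) - + 2) only reduces to C′ k once k is a constructor.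
  recurrence : ∀ k → (Cℤ n (+ suc k) r ⊎ Cℤ n (+ suc k - + 2) r)
                     ↔ Σ (Σ ℤ (λ s → T (inR n 1 s))) (λ s → Cℤ n (+ suc k - + 1) (r + proj₁ s))
  recurrence zero    = ↔-trans (first-entry↔ zero r) (↔-sym (R₁-reindex↔ zero r))
  recurrence (suc k) = ↔-trans (first-entry↔ (suc k) r) (↔-sym (R₁-reindex↔ (suc k) r))
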